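{- Let $\mathbf{K}$ be a local class of $\Sigma$-structures. For every $B\in\mathbf{K}$ and every $k<\|B\|$, \[N(B,k)=\prod_{X\subseteq|B|,\ \|X\|=k+1}N(B\restriction X,k).\]
   Context: A relational signature $\Sigma$ is locally finite if it has finitely many $n$-ary relation symbols for each $n$. General Irreflexivity axioms: for every $R\in\Sigma$ of arity $n\ge2$ and distinct $i,j$, $\forall\bar x\,(R(x_1,\dots,x_n)\to x_i\ne x_j)$. A local sentence has the form $\forall x_1\cdots\forall x_m(R(x_1,\dots,x_m)\to\psi)$, $m>0$, $R\in\Sigma$ of arity $m$, $\psi$ quantifier-free. A local class is the class $\mathbf{K}$ of all finite $\Sigma$-structures (with $\Sigma$ locally finite relational) with underlying set a subset of $\mathbb{N}$ satisfying a set $\Phi$ of local sentences containing all General Irreflexivity axioms. $|M|$ is the underlying set and $\|M\|$ the cardinality of $M$; $B\restriction X$ is the induced substructure on $X$. The $k$-frame $A^{(k)}$ keeps the underlying set and relations of arity $\le k$ and empties relations of higher arity. $N(S,k)$ is the number of distinct $(k+1)$-frames of structures $T\in\mathbf{K}$ with $|T|=|S|$ and $T^{(k)}=S^{(k)}$. -}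

module Defs where

open import Data.Nat using (ℕ; zero; suc; _<_; _≤ᵇ_)
open import Data.Nat.Properties using (<-cmp)
import Data.Nat.Properties as ℕP
open import Data.Bool using (Bool; true; false; T; _∧_; if_then_else_)
open import Data.Bool.Properties using (T-∧)
open import Data.Fin using (Fin)
open import Data.Vec using (Vec; tabulate) renaming (map to vmap)
open import Data.Vec.Relation.Unary.All using () renaming (All to VAll; all? to vall?)
open import Data.List using (List; []; _∷_; _++_; map; filter; length)
open import Data.List.Membership.Propositional using (_∈_)
open import Data.List.Membership.DecPropositional ℕP._≟_ using (_∈?_)
open import Data.List.Relation.Unary.All using (All)
open import Data.List.Relation.Unary.Any using (Any)
open import Data.List.Relation.Unary.AllPairs using (AllPairs)
import Data.List.Relation.Unary.AllPairs.Properties as APP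
open import Data.Product using (Σ; _×_; _,_; proj₁; proj₂)
open import Data.Empty using (⊥)
open import Data.Unit using (⊤)
open import Relation.Nullary using (¬_; does)
open import Relation.Nullary.Decidable using (toWitness; ⌊_⌋)
open import Relation.Binary.PropositionalEquality using (_≡_; _≢_)
open import Function using (_⇔_)

-- Locally finite relational signature: σ n = number of n-ary symbols;
-- the n-ary symbols are Fin (σ n).
Signature : Set
Signature = ℕ → ℕ

-- The underlying set is stored canonically as a strictly increasing list.
record Struct (σ : Signature) : Set where
  field
    univ   : List ℕ
    sorted : AllPairs _<_ univ
    rel    : ∀ {n} → Fin (σ n) → Vec ℕ n → Bool
    rel-in : ∀ {n} (r : Fin (σ n)) (t : Vec ℕ n) → T (rel r t) → VAll (_∈ univ) t
open Struct public

_≈S_ : ∀ {σ} → Struct σ → Struct σ → Set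
A ≈S B = (univ A ≡ univ B) × (∀ n (r : Fin _) (t : Vec ℕ n) → rel A r t ≡ rel B r t)

frame : ∀ {σ} → ℕ → Struct σ → Struct σ
frame {σ} k M = record
  { univ = univ M ; sorted = sorted M ; rel = rl ; rel-in = rl-in }
  where
  rl : ∀ {n} → Fin (σ n) → Vec ℕ n → Bool
  rl {n} r t = if n ≤ᵇ k then rel M r t else false
  rl-in : ∀ {n} (r : Fin (σ n)) (t : Vec ℕ n) → T (rl r t) → VAll (_∈ univ M) t
  rl-in {n} r t h with n ≤ᵇ k
  ... | true  = rel-in M r t h
  ... | false = Data.Empty.⊥-elim h
    where import Data.Empty

allIn : ∀ {n} → List ℕ → Vec ℕ n → Bool
allIn U t = ⌊ vall? (_∈? U) t ⌋

restrict : ∀ {σ} → Struct σ → List ℕ → Struct σ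
restrict {σ} B X = record
  { univ = U ; sorted = APP.filter⁺ (_∈? X) (sorted B) ; rel = rl ; rel-in = rl-in }
  where
  U : List ℕ
  U = filter (_∈? X) (univ B)
  rl : ∀ {n} → Fin (σ n) → Vec ℕ n → Bool
  rl r t = rel B r t ∧ allIn U t
  rl-in : ∀ {n} (r : Fin (σ n)) (t : Vec ℕ n) → T (rl r t) → VAll (_∈ U) t
  rl-in r t h = toWitness {a? = vall? (_∈? U) t} (proj₂ (Function.Equivalence.to (T-∧ {rel B r t} {allIn U t}) h))
    where import Function

syntax restrict B X = B ↾ X

data QF (σ : Signature) (m : ℕ) : Set where
  tt ff : QF σ m
  eq    : Fin m → Fin m → QF σ m
  atom  : ∀ {n} → Fin (σ n) → Vec (Fin m) n → QF σ m
  neg   : QF σ m → QF σ m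
  and or imp : QF σ m → QF σ m → QF σ m

⟦_⟧ : ∀ {σ m} → QF σ m → Struct σ → (Fin m → ℕ) → Set
⟦ tt ⟧ M a = ⊤
⟦ ff ⟧ M a = ⊥
⟦ eq i j ⟧ M a = a i ≡ a j
⟦ atom r xs ⟧ M a = T (rel M r (vmap a xs))
⟦ neg φ ⟧ M a = ¬ ⟦ φ ⟧ M a
⟦ and φ ψ ⟧ M a = ⟦ φ ⟧ M a × ⟦ ψ ⟧ M a
⟦ or φ ψ ⟧ M a = Data.Sum._⊎_ (⟦ φ ⟧ M a) (⟦ ψ ⟧ M a)
  where import Data.Sum
⟦ imp φ ψ ⟧ M a = ⟦ φ ⟧ M a → ⟦ ψ ⟧ M a

-- Local sentence ∀x₁…x_m (R(x₁,…,x_m) → ψ), with m = suc arity' > 0.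
record Local (σ : Signature) : Set where
  constructor local
  field
    arity' : ℕ
    sym    : Fin (σ (suc arity'))
    body   : QF σ (suc arity')

_⊨_ : ∀ {σ} → Struct σ → Local σ → Set
M ⊨ local m R ψ =
  (a : Fin (suc m) → ℕ) → (∀ i → a i ∈ univ M) → T (rel M R (tabulate a)) → ⟦ ψ ⟧ M a

irr : ∀ {σ} m → Fin (σ (suc m)) → Fin (suc m) → Fin (suc m) → Local σ
irr m R i j = local m R (neg (eq i j))

ContainsIrr : ∀ {σ} → (Local σ → Set) → Set
ContainsIrr {σ} Φ = ∀ m (R : Fin (σ (suc m))) (i j : Fin (suc m)) → i ≢ j → Φ (irr m R i j)

InK : ∀ {σ} → (Local σ → Set) → Struct σ → Set
InK Φ M = ∀ φ → Φ φ → M ⊨ φ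

IsFrameOf : ∀ {σ} → (Local σ → Set) → Struct σ → ℕ → Struct σ → Set
IsFrameOf {σ} Φ S k F = Σ (Struct σ) λ T′ →
  InK Φ T′ × (univ T′ ≡ univ S) × (frame k T′ ≈S frame k S) × (F ≈S frame (suc k) T′)

IsN : ∀ {σ} → (Local σ → Set) → Struct σ → ℕ → ℕ → Set
IsN {σ} Φ S k n = Σ (List (Struct σ)) λ Fs →
  (length Fs ≡ n) × All (IsFrameOf Φ S k) Fs × AllPairs (λ A B → ¬ (A ≈S B)) Fs
  × (∀ F → IsFrameOf Φ S k F → Any (F ≈S_) Fs)

-- All sublists of length k (= all k-element subsets of a duplicate-free list).
choose : ∀ {A : Set} → ℕ → List A → List (List A)
choose zero    _        = [] ∷ []
choose (suc k) []       = []
choose (suc k) (x ∷ xs) = map (x ∷_) (choose k xs) ++ choose (suc k) xs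

-- Restriction to the (k+1)-element subsets X of |B| is a bijection between the (k+1)-frames over B
-- and the families of (k+1)-frames over the B ↾ X. A frame agrees with B in arities ≤ k and is empty
-- above k+1; by irreflexivity each of its (k+1)-tuples has k+1 distinct entries and so lies inside
-- exactly one X. Hence a frame is determined by its restrictions. Conversely a family of frames over
-- the B ↾ X glues, by taking the union of their (k+1)-ary relations, to a frame over B: a local
-- sentence only inspects tuples over the entries of its guard tuple, and on those the glued structure
-- agrees with B or with the single piece containing the guard. Counting families gives the product.

module Submission where

open import Defs
open import Data.Nat using (ℕ; zero; suc; _≤_; _<_; _≤ᵇ_; _+_; _*_; z≤n; s≤s)
import Data.Nat.Properties as ℕ
open import Data.Nat.ListAction using (product)
open import Data.Bool using (Bool; true; false; T; _∧_; _∨_; if_then_else_)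
open import Data.Bool.Properties using (T-≡; T-∧; T-∨; ⇔→≡; ∧-identityʳ)
open import Data.Unit using (tt)
open import Data.Empty using (⊥-elim)
open import Data.Product using (Σ; ∃; ∃₂; _×_; _,_; proj₁; proj₂)
open import Data.Sum using (_⊎_; inj₁; inj₂)
open import Data.Fin using (Fin; _≟_)
import Data.Fin.Properties as Fin
open import Data.Vec using (Vec; lookup; tabulate; toList) renaming (map to vmap)
open import Data.Vec.Properties using (tabulate∘lookup; lookup-map; length-toList)
open import Data.Vec.Relation.Unary.All using () renaming (All to VAll; all? to vall?)
import Data.Vec.Relation.Unary.All as VAll
import Data.Vec.Relation.Unary.All.Properties as VAll
open import Data.List using (List; []; _∷_; [_]; _++_; map; filter; length; removeAt; cartesianProductWith)
import Data.List as List
open import Data.List.Properties using (length-++; length-map; length-removeAt′; ∷-injectiveʳ)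
open import Data.List.Membership.Propositional using (_∈_; _∉_; find)
open import Data.List.Membership.DecPropositional ℕ._≟_ using (_∈?_)
open import Data.List.Membership.Propositional.Properties
  using (∈-filter⁺; ∈-filter⁻; ∈-map⁻; ∈-map⁺; ∈-++⁻; ∈-++⁺ˡ; ∈-++⁺ʳ)
open import Data.List.Relation.Unary.All as All using (All; []; _∷_)
import Data.List.Relation.Unary.All.Properties as All
open import Data.List.Relation.Unary.Any as Any using (Any; here; there)
import Data.List.Relation.Unary.Any.Properties as Any
open import Data.List.Relation.Unary.AllPairs using ([]; _∷_)
import Data.List.Relation.Unary.AllPairs as AllPairs
open import Data.List.Relation.Unary.Unique.Propositional using (Unique)
import Data.List.Relation.Unary.Unique.Propositional.Properties as Unique
open import Data.List.Relation.Unary.Unique.Setoid using () renaming (Unique to Uniqueₛ)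
import Data.List.Relation.Unary.Unique.Setoid.Properties as Uniqueₛ
open import Data.List.Relation.Binary.Disjoint.Propositional using (Disjoint)
open import Data.List.Relation.Binary.Pointwise as Pointwise using (Pointwise; []; _∷_)
open import Data.List.Relation.Binary.Sublist.Propositional
  using ([]; _∷_; _∷ʳ_; minimum) renaming (_⊆_ to _⊑_; lookup to ⊑-lookup)
open import Data.List.Relation.Binary.Sublist.Propositional.Properties using (filter-⊆)
open import Function using (id; _∘_; mk⇔; Equivalence)
open import Level using (0ℓ)
open import Relation.Nullary using (¬_; yes; no)
open import Relation.Nullary.Decidable using (toWitness; fromWitness)
open import Relation.Binary using (tri<; tri≈; tri>)
open import Relation.Binary.Bundles using (Setoid)
open import Relation.Binary.PropositionalEquality using (_≡_; _≢_; refl; cong; cong₂; subst)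
import Relation.Binary.PropositionalEquality as ≡
import Relation.Binary.Reasoning.Setoid as SetoidReasoning

-- Counting duplicate-free lists

module _ {c ℓ} (S : Setoid c ℓ) where
  open Setoid S renaming (Carrier to A)
  open import Data.List.Membership.Setoid S renaming (_∈_ to _∈ₛ_)

  ∈-removeAt : ∀ {x y ys} (p : x ∈ₛ ys) → y ∈ₛ ys → x ≉ y → y ∈ₛ removeAt ys (Any.index p)
  ∈-removeAt (here x≈z) (here y≈z) x≉y = ⊥-elim (x≉y (trans x≈z (sym y≈z)))
  ∈-removeAt (here _)   (there q)  _   = q
  ∈-removeAt (there p)  (here y≈z) _   = here y≈z
  ∈-removeAt (there p)  (there q)  x≉y = there (∈-removeAt p q x≉y)

  Unique-⊆⇒length≤ : ∀ {xs ys} → Uniqueₛ S xs → All (_∈ₛ ys) xs → length xs ≤ length ys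
  Unique-⊆⇒length≤ [] [] = z≤n
  Unique-⊆⇒length≤ {_ ∷ xs} {ys} (x≉xs ∷ xs!) (x∈ys ∷ xs⊆ys) = begin
    suc (length xs)                              ≤⟨ s≤s (Unique-⊆⇒length≤ xs! xs⊆ys∖x) ⟩
    suc (length (removeAt ys (Any.index x∈ys)))  ≡⟨ length-removeAt′ ys (Any.index x∈ys) ⟨
    length ys                                    ∎
    where
    open ℕ.≤-Reasoning
    xs⊆ys∖x : All (_∈ₛ removeAt ys (Any.index x∈ys)) xs
    xs⊆ys∖x = All.zipWith (λ (x≉y , y∈ys) → ∈-removeAt x∈ys y∈ys x≉y) (x≉xs , xs⊆ys)

  Unique-⊆-⊇⇒length≡ : ∀ {xs ys} → Uniqueₛ S xs → Uniqueₛ S ys →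
                       All (_∈ₛ ys) xs → All (_∈ₛ xs) ys → length xs ≡ length ys
  Unique-⊆-⊇⇒length≡ xs! ys! xs⊆ys ys⊆xs =
    ℕ.≤-antisym (Unique-⊆⇒length≤ xs! xs⊆ys) (Unique-⊆⇒length≤ ys! ys⊆xs)

module _ {a b ℓ₁ ℓ₂} (S : Setoid a ℓ₁) (T : Setoid b ℓ₂) where
  open Setoid S using () renaming (Carrier to A; _≈_ to _≈₁_)
  open Setoid T using () renaming (Carrier to B; _≈_ to _≈₂_)

  Unique-map⁺-injectiveOn : ∀ {p} {P : A → Set p} {f : A → B} {xs} →
    (∀ {x y} → P x → P y → f x ≈₂ f y → x ≈₁ y) → All P xs → Uniqueₛ S xs → Uniqueₛ T (map f xs)
  Unique-map⁺-injectiveOn inj [] [] = []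
  Unique-map⁺-injectiveOn inj (px ∷ pxs) (x≉xs ∷ xs!) =
    All.map⁺ (All.zipWith (λ (py , x≉y) fx≈fy → x≉y (inj px py fx≈fy)) (pxs , x≉xs))
    ∷ Unique-map⁺-injectiveOn inj pxs xs!

-- Subsets of a duplicate-free list

module _ {A : Set} where

  ∉-⊑ : ∀ {z : A} {xs ys} → xs ⊑ ys → All (z ≢_) ys → z ∉ xs
  ∉-⊑ τ z∉ys z∈xs = All.lookup z∉ys (⊑-lookup τ z∈xs) refl

  ⊆-∷⁻ : ∀ {z : A} {xs ys} → z ∉ xs → All (_∈ z ∷ ys) xs → All (_∈ ys) xs
  ⊆-∷⁻ {z} {xs} {ys} z∉xs xs⊆ = All.tabulate λ w∈xs → drop-z w∈xs (All.lookup xs⊆ w∈xs)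
    where
    drop-z : ∀ {w} → w ∈ xs → w ∈ z ∷ ys → w ∈ ys
    drop-z w∈xs (here refl) = ⊥-elim (z∉xs w∈xs)
    drop-z _    (there w∈ys) = w∈ys

  ⊑-ext : ∀ {xs ys zs : List A} → Unique zs → xs ⊑ zs → ys ⊑ zs →
          All (_∈ ys) xs → All (_∈ xs) ys → xs ≡ ys
  ⊑-ext [] [] [] _ _ = refl
  ⊑-ext (_ ∷ zs!) (z ∷ʳ τ) (z ∷ʳ τ′) xs⊆ys ys⊆xs = ⊑-ext zs! τ τ′ xs⊆ys ys⊆xs
  ⊑-ext (z∉zs ∷ _) (refl ∷ τ) (z ∷ʳ τ′) (z∈ys ∷ _) _ = ⊥-elim (∉-⊑ τ′ z∉zs z∈ys)
  ⊑-ext (z∉zs ∷ _) (z ∷ʳ τ) (refl ∷ τ′) _ (z∈xs ∷ _) = ⊥-elim (∉-⊑ τ z∉zs z∈xs)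
  ⊑-ext {z ∷ _} (z∉zs ∷ zs!) (refl ∷ τ) (refl ∷ τ′) (_ ∷ xs⊆ys) (_ ∷ ys⊆xs) =
    cong (z ∷_) (⊑-ext zs! τ τ′ (⊆-∷⁻ (∉-⊑ τ z∉zs) xs⊆ys) (⊆-∷⁻ (∉-⊑ τ′ z∉zs) ys⊆xs))

⊆-length≥⇒⊇ : ∀ {ts X : List ℕ} → Unique ts → All (_∈ X) ts → length X ≤ length ts → All (_∈ ts) X
⊆-length≥⇒⊇ {ts} {X} ts! ts⊆X X≤ts = All.tabulate member
  where
  member : ∀ {x} → x ∈ X → x ∈ ts
  member {x} x∈X with x ∈? ts
  ... | yes x∈ts = x∈ts
  ... | no  x∉ts = ⊥-elim (ℕ.<⇒≱ (Unique-⊆⇒length≤ (≡.setoid ℕ) x∷ts! (x∈X ∷ ts⊆X)) X≤ts)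
    where
    x∷ts! : Unique (x ∷ ts)
    x∷ts! = All.tabulate (λ y∈ts x≡y → x∉ts (subst (_∈ ts) (≡.sym x≡y) y∈ts)) ∷ ts!

module _ {A : Set} where

  choose⁻ : ∀ n (U : List A) {X} → X ∈ choose n U → X ⊑ U × length X ≡ n
  choose⁻ zero    U        (here refl) = minimum U , refl
  choose⁻ (suc n) (x ∷ U) X∈ with ∈-++⁻ (map (x ∷_) (choose n U)) X∈
  ... | inj₁ X∈map with ∈-map⁻ (x ∷_) X∈map
  ...   | Y , Y∈ , refl with choose⁻ n U Y∈
  ...     | Y⊑U , refl = refl ∷ Y⊑U , refl
  choose⁻ (suc n) (x ∷ U) X∈ | inj₂ X∈rest with choose⁻ (suc n) U X∈rest
  ... | X⊑U , lenX = x ∷ʳ X⊑U , lenX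

  choose⁺ : ∀ {X U : List A} → X ⊑ U → X ∈ choose (length X) U
  choose⁺ []         = here refl
  choose⁺ (refl ∷ τ) = ∈-++⁺ˡ (∈-map⁺ _ (choose⁺ τ))
  choose⁺ {[]}    (_ ∷ʳ τ) = here refl
  choose⁺ {_ ∷ X} (u ∷ʳ τ) = ∈-++⁺ʳ (map (u ∷_) (choose (length X) _)) (choose⁺ τ)

  choose-Unique : ∀ n {U : List A} → Unique U → Unique (choose n U)
  choose-Unique zero    _ = [] ∷ []
  choose-Unique (suc n) {[]}    _ = []
  choose-Unique (suc n) {x ∷ U} (x∉U ∷ U!) =
    Unique.++⁺ (Unique.map⁺ ∷-injectiveʳ (choose-Unique n U!)) (choose-Unique (suc n) U!) disjoint
    where
    disjoint : Disjoint (map (x ∷_) (choose n U)) (choose (suc n) U)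
    disjoint (X∈map , X∈choose) with ∈-map⁻ (x ∷_) X∈map
    ... | _ , _ , refl = ∉-⊑ (proj₁ (choose⁻ (suc n) U X∈choose)) x∉U (here refl)

support : List ℕ → List ℕ → List ℕ
support U ts = filter (_∈? ts) U

support∈choose : ∀ {n U ts} → Unique U → Unique ts → All (_∈ U) ts → length ts ≡ n →
                 support U ts ∈ choose n U
support∈choose {U = U} {ts} U! ts! ts⊆U refl =
  subst (λ m → support U ts ∈ choose m U) length-support (choose⁺ (filter-⊆ (_∈? ts) U))
  where
  length-support : length (support U ts) ≡ length ts
  length-support = Unique-⊆-⊇⇒length≡ (≡.setoid ℕ) (Unique.filter⁺ (_∈? ts) U!) ts!
    (All.tabulate (λ x∈ → proj₂ (∈-filter⁻ (_∈? ts) {xs = U} x∈)))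
    (All.tabulate (λ x∈ts → ∈-filter⁺ (_∈? ts) (All.lookup ts⊆U x∈ts) x∈ts))

choose-⊇⇒≡support : ∀ {n U ts X} → Unique U → Unique ts → X ∈ choose n U → length ts ≡ n →
                    All (_∈ X) ts → X ≡ support U ts
choose-⊇⇒≡support {n} {U} {ts} {X} U! ts! X∈ refl ts⊆X = ⊑-ext U! X⊑U (filter-⊆ (_∈? ts) U)
  (All.tabulate (λ x∈X → ∈-filter⁺ (_∈? ts) (⊑-lookup X⊑U x∈X) (All.lookup X⊆ts x∈X)))
  (All.tabulate (λ x∈ → All.lookup ts⊆X (proj₂ (∈-filter⁻ (_∈? ts) {xs = U} x∈))))
  where
  X⊑U : X ⊑ U
  X⊑U = proj₁ (choose⁻ n U X∈)
  X⊆ts : All (_∈ ts) X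
  X⊆ts = ⊆-length≥⇒⊇ ts! ts⊆X (ℕ.≤-reflexive (proj₂ (choose⁻ n U X∈)))

-- Choosing one element from each list

module _ {A B C : Set} where

  length-cartesianProductWith : ∀ (f : A → B → C) xs ys →
    length (cartesianProductWith f xs ys) ≡ length xs * length ys
  length-cartesianProductWith f []       ys = refl
  length-cartesianProductWith f (x ∷ xs) ys = begin
    length (map (f x) ys ++ cartesianProductWith f xs ys)  ≡⟨ length-++ (map (f x) ys) ⟩
    length (map (f x) ys) + length (cartesianProductWith f xs ys)
      ≡⟨ cong₂ _+_ (length-map (f x) ys) (length-cartesianProductWith f xs ys) ⟩
    length ys + length xs * length ys  ∎
    where open ≡.≡-Reasoning

module _ {A : Set} where

  choices : List (List A) → List (List A)
  choices []       = [ [] ]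
  choices (L ∷ Ls) = cartesianProductWith _∷_ L (choices Ls)

  length-choices : ∀ Ls → length (choices Ls) ≡ product (map length Ls)
  length-choices []       = refl
  length-choices (L ∷ Ls) = ≡.trans (length-cartesianProductWith _∷_ L (choices Ls))
                                    (cong (length L *_) (length-choices Ls))

  choices⁻ : ∀ Ls → All (λ c → Pointwise _∈_ c Ls) (choices Ls)
  choices⁻ []       = [] ∷ []
  choices⁻ (L ∷ Ls) = All.cartesianProductWith⁺ (≡.setoid A) (≡.setoid (List A)) _∷_ L (choices Ls)
    (λ x∈L c∈ → x∈L ∷ All.lookup (choices⁻ Ls) c∈)

  choices⁺ : ∀ {c} Ls → Pointwise _∈_ c Ls → c ∈ choices Ls
  choices⁺ []       []           = here refl
  choices⁺ (L ∷ Ls) (x∈L ∷ c∈Ls) =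
    Any.cartesianProductWith⁺ _∷_ (λ { refl refl → refl }) x∈L (choices⁺ Ls c∈Ls)

module _ {ℓ} (S : Setoid 0ℓ ℓ) where

  choices-Unique : ∀ {Ls} → All (Uniqueₛ S) Ls → Uniqueₛ (Pointwise.setoid S) (choices Ls)
  choices-Unique []          = [] ∷ []
  choices-Unique (L! ∷ Ls!) = Uniqueₛ.cartesianProductWith⁺ S (Pointwise.setoid S) (Pointwise.setoid S)
    _∷_ (λ { (x≈y ∷ xs≋ys) → x≈y , xs≋ys }) L! (choices-Unique Ls!)

data Aligned {A B : Set} (x : A) (y : B) : List A → List B → Set where
  here  : ∀ {xs ys} → Aligned x y (x ∷ xs) (y ∷ ys)
  there : ∀ {x′ y′ xs ys} → Aligned x y xs ys → Aligned x y (x′ ∷ xs) (y′ ∷ ys)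

module _ {A B : Set} where

  Aligned-∈ : ∀ {x : A} {y : B} {xs ys} → Aligned x y xs ys → x ∈ xs
  Aligned-∈ here      = here refl
  Aligned-∈ (there a) = there (Aligned-∈ a)

  Pointwise-Aligned : ∀ {R : A → B → Set} {x y xs ys} → Pointwise R xs ys → Aligned x y xs ys → R x y
  Pointwise-Aligned (rxy ∷ _)   here      = rxy
  Pointwise-Aligned (_   ∷ rxs) (there a) = Pointwise-Aligned rxs a

  Pointwise⇒Aligned : ∀ {R : A → B → Set} {x xs ys} → Pointwise R xs ys → x ∈ xs → ∃ λ y → Aligned x y xs ys
  Pointwise⇒Aligned (_ ∷ _)   (here refl) = _ , here
  Pointwise⇒Aligned (_ ∷ rxs) (there x∈) = let y , a = Pointwise⇒Aligned rxs x∈ in y , there a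

  Pointwise-tabulate : ∀ {R S : A → B → Set} {xs ys} → Pointwise S xs ys →
                       (∀ {x y} → Aligned x y xs ys → R x y) → Pointwise R xs ys
  Pointwise-tabulate []        f = []
  Pointwise-tabulate (_ ∷ sxs) f = f here ∷ Pointwise-tabulate sxs (f ∘ there)

  Aligned-functional : ∀ {x : A} {y y′ : B} {xs ys} → Unique xs →
                       Aligned x y xs ys → Aligned x y′ xs ys → y ≡ y′
  Aligned-functional _           here      here       = refl
  Aligned-functional (x∉xs ∷ _) here      (there a′) = ⊥-elim (All.lookup x∉xs (Aligned-∈ a′) refl)
  Aligned-functional (x∉xs ∷ _) (there a) here       = ⊥-elim (All.lookup x∉xs (Aligned-∈ a) refl)
  Aligned-functional (_ ∷ xs!)  (there a) (there a′) = Aligned-functional xs! a a′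

  Pointwise-Any⇒choice : ∀ {R : A → B → Set} {xs Ls} → Pointwise (λ x L → Any (R x) L) xs Ls →
                         ∃ λ c → Pointwise _∈_ c Ls × Pointwise R xs c
  Pointwise-Any⇒choice []            = [] , [] , []
  Pointwise-Any⇒choice (any ∷ anys) =
    let y , y∈L , rxy = find any ; c , c∈Ls , rxsc = Pointwise-Any⇒choice anys
    in y ∷ c , y∈L ∷ c∈Ls , rxy ∷ rxsc

  Pointwise-All-∈ : ∀ {R : A → B → Set} {xs Ls c} → Pointwise (λ x L → All (R x) L) xs Ls →
                    Pointwise _∈_ c Ls → Pointwise R xs c
  Pointwise-All-∈ []             []           = []
  Pointwise-All-∈ (rxL ∷ rxsLs) (y∈L ∷ c∈Ls) = All.lookup rxL y∈L ∷ Pointwise-All-∈ rxsLs c∈Ls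

  All-unzipΣ : ∀ {R : A → List B → Set} {f : A → ℕ} {xs} →
               All (λ x → Σ (List B) λ L → (length L ≡ f x) × R x L) xs →
               Σ (List (List B)) λ Ls → (map length Ls ≡ map f xs) × Pointwise R xs Ls
  All-unzipΣ []                    = [] , refl , []
  All-unzipΣ ((L , len , rxL) ∷ ps) =
    let Ls , lens , rxsLs = All-unzipΣ ps in L ∷ Ls , cong₂ _∷_ len lens , rxL ∷ rxsLs

  Pointwise-All : ∀ {P : B → Set} {xs : List A} {ys} → Pointwise (λ _ y → P y) xs ys → All P ys
  Pointwise-All []          = []
  Pointwise-All (py ∷ pys) = py ∷ Pointwise-All pys

-- Structures, frames and restrictions

T-ext : ∀ {a b} → (T a → T b) → (T b → T a) → a ≡ b
T-ext a⇒b b⇒a = ⇔→≡ {z = true} (mk⇔ (to T-≡ ∘ a⇒b ∘ from T-≡) (to T-≡ ∘ b⇒a ∘ from T-≡))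
  where open Equivalence

¬T⇒≡false : ∀ {b} → ¬ T b → b ≡ false
¬T⇒≡false {false} _  = refl
¬T⇒≡false {true}  ¬t = ⊥-elim (¬t tt)

≤ᵇ-true : ∀ {m n} → m ≤ n → (m ≤ᵇ n) ≡ true
≤ᵇ-true = Equivalence.to T-≡ ∘ ℕ.≤⇒≤ᵇ

≤ᵇ-false : ∀ {m n} → n < m → (m ≤ᵇ n) ≡ false
≤ᵇ-false {m} {n} n<m = ¬T⇒≡false (ℕ.<⇒≱ n<m ∘ ℕ.≤ᵇ⇒≤ m n)

data ArityCase (k : ℕ) : ℕ → Set where
  below : ∀ {n} → n ≤ k → ArityCase k n
  at    : ArityCase k (suc k)
  above : ∀ {n} → suc k < n → ArityCase k n

arityCase : ∀ k n → ArityCase k n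
arityCase k n with ℕ.<-cmp n (suc k)
... | tri< n<1+k _ _ = below (ℕ.≤-pred n<1+k)
... | tri≈ _ refl _  = at
... | tri> _ _ 1+k<n = above 1+k<n

toList≡tabulate∘lookup : ∀ {A : Set} {n} (t : Vec A n) → toList t ≡ List.tabulate (lookup t)
toList≡tabulate∘lookup Vec.[]      = refl
toList≡tabulate∘lookup (x Vec.∷ t) = cong (x ∷_) (toList≡tabulate∘lookup t)

VAll-lookup : ∀ {P : ℕ → Set} {n} {t : Vec ℕ n} → VAll P t → ∀ i → P (lookup t i)
VAll-lookup {P} {t = t} pt = VAll.tabulate⁻ (subst (VAll P) (≡.sym (tabulate∘lookup t)) pt)

VAll-vmap : ∀ {P : ℕ → Set} {m n} (a : Fin m → ℕ) (xs : Vec (Fin m) n) → (∀ i → P (a i)) → VAll P (vmap a xs)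
VAll-vmap a xs pa = VAll.map⁺ (VAll.universal pa xs)

allIn-true : ∀ {n} {U : List ℕ} {t : Vec ℕ n} → VAll (_∈ U) t → allIn U t ≡ true
allIn-true t⊆U = Equivalence.to T-≡ (fromWitness t⊆U)

allIn-sound : ∀ {n} {U : List ℕ} {t : Vec ℕ n} → T (allIn U t) → VAll (_∈ U) t
allIn-sound {U = U} {t} = toWitness {a? = vall? (_∈? U) t}

module _ {σ : Signature} where

  ≈S-refl : ∀ {A : Struct σ} → A ≈S A
  ≈S-refl = refl , λ _ _ _ → refl

  ≈S-sym : ∀ {A B : Struct σ} → A ≈S B → B ≈S A
  ≈S-sym (U≡ , rel≡) = ≡.sym U≡ , λ n r t → ≡.sym (rel≡ n r t)

  ≈S-trans : ∀ {A B C : Struct σ} → A ≈S B → B ≈S C → A ≈S C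
  ≈S-trans (U≡ , rel≡) (U≡′ , rel≡′) = ≡.trans U≡ U≡′ , λ n r t → ≡.trans (rel≡ n r t) (rel≡′ n r t)

  ↾-resp-≈S : ∀ {A A′ : Struct σ} X → A ≈S A′ → (A ↾ X) ≈S (A′ ↾ X)
  ↾-resp-≈S X (U≡ , rel≡) = cong (filter (_∈? X)) U≡ ,
    λ n r t → cong₂ _∧_ (rel≡ n r t) (cong (λ V → allIn (filter (_∈? X) V) t) U≡)

  rel-frame-≤ : ∀ {j n} (M : Struct σ) (r : Fin (σ n)) t → n ≤ j → rel (frame j M) r t ≡ rel M r t
  rel-frame-≤ M r t n≤j rewrite ≤ᵇ-true n≤j = refl

  rel-frame-> : ∀ {j n} (M : Struct σ) (r : Fin (σ n)) t → j < n → rel (frame j M) r t ≡ false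
  rel-frame-> M r t j<n rewrite ≤ᵇ-false j<n = refl

  rel-↾ : ∀ {n} (M : Struct σ) X (r : Fin (σ n)) {t} → VAll (_∈ univ (M ↾ X)) t → rel (M ↾ X) r t ≡ rel M r t
  rel-↾ M X r {t} t⊆ = ≡.trans (cong (rel M r t ∧_) (allIn-true t⊆)) (∧-identityʳ _)

  AgreeOn : ∀ {m} → Struct σ → Struct σ → (Fin m → ℕ) → Set
  AgreeOn {m} M N a = ∀ {n} (r : Fin (σ n)) (xs : Vec (Fin m) n) → rel M r (vmap a xs) ≡ rel N r (vmap a xs)

  ⟦⟧-cong : ∀ {m} (ψ : QF σ m) {M N : Struct σ} {a} → AgreeOn M N a → ⟦ ψ ⟧ M a ≡ ⟦ ψ ⟧ N a
  ⟦⟧-cong tt          agree = refl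
  ⟦⟧-cong ff          agree = refl
  ⟦⟧-cong (eq i j)    agree = refl
  ⟦⟧-cong (atom r xs) agree = cong T (agree r xs)
  ⟦⟧-cong (neg ψ)     agree = cong ¬_ (⟦⟧-cong ψ agree)
  ⟦⟧-cong (and ψ χ)   agree = cong₂ _×_ (⟦⟧-cong ψ agree) (⟦⟧-cong χ agree)
  ⟦⟧-cong (or ψ χ)    agree = cong₂ _⊎_ (⟦⟧-cong ψ agree) (⟦⟧-cong χ agree)
  ⟦⟧-cong (imp ψ χ)   agree = cong₂ (λ A B → A → B) (⟦⟧-cong ψ agree) (⟦⟧-cong χ agree)

  ↾-AgreeOn : ∀ {m} (M : Struct σ) X {a : Fin m → ℕ} → (∀ i → a i ∈ univ (M ↾ X)) → AgreeOn (M ↾ X) M a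
  ↾-AgreeOn M X {a} a∈ r xs = rel-↾ M X r (VAll-vmap a xs a∈)

Struct-setoid : Signature → Setoid 0ℓ 0ℓ
Struct-setoid σ = record
  { Carrier = Struct σ ; _≈_ = _≈S_
  ; isEquivalence = record
    { refl = λ {A} → ≈S-refl {A = A}
    ; sym = λ {A} {B} → ≈S-sym {A = A} {B}
    ; trans = λ {A} {B} {C} → ≈S-trans {A = A} {B} {C} } }

module _ {σ : Signature} where

  frame-≈S : ∀ {j} {M N : Struct σ} → univ M ≡ univ N →
             (∀ {n} (r : Fin (σ n)) t → n ≤ j → rel M r t ≡ rel N r t) → frame j M ≈S frame j N
  frame-≈S {j} {M} {N} U≡ low = U≡ , agree
    where
    agree : ∀ n (r : Fin (σ n)) t → rel (frame j M) r t ≡ rel (frame j N) r t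
    agree n r t with n ≤ᵇ j in n≤ᵇj
    ... | true  = low r t (ℕ.≤ᵇ⇒≤ n j (subst T (≡.sym n≤ᵇj) tt))
    ... | false = refl

  frame-≈S⁻ : ∀ {j n} {M N : Struct σ} → frame j M ≈S frame j N →
              (r : Fin (σ n)) (t : Vec ℕ n) → n ≤ j → rel M r t ≡ rel N r t
  frame-≈S⁻ {M = M} {N} (_ , rel≡) r t n≤j =
    ≡.trans (≡.sym (rel-frame-≤ M r t n≤j)) (≡.trans (rel≡ _ r t) (rel-frame-≤ N r t n≤j))

  ≈S-frame : ∀ {j} (M : Struct σ) → (∀ {n} (r : Fin (σ n)) t → j < n → rel M r t ≡ false) → M ≈S frame j M
  ≈S-frame {j} M high = refl , agree
    where
    agree : ∀ n (r : Fin (σ n)) t → rel M r t ≡ rel (frame j M) r t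
    agree n r t with n ℕ.≤? j
    ... | yes n≤j = ≡.sym (rel-frame-≤ M r t n≤j)
    ... | no  n≰j = ≡.trans (high r t (ℕ.≰⇒> n≰j)) (≡.sym (rel-frame-> M r t (ℕ.≰⇒> n≰j)))

  frame-↾ : ∀ j (M : Struct σ) X → (frame j M ↾ X) ≈S frame j (M ↾ X)
  frame-↾ j M X = refl , agree
    where
    agree : ∀ n (r : Fin (σ n)) t → rel (frame j M ↾ X) r t ≡ rel (frame j (M ↾ X)) r t
    agree n r t with n ≤ᵇ j
    ... | true  = refl
    ... | false = refl

  module _ {Φ : Local σ → Set} where

    InK-↾ : ∀ {M} → InK Φ M → ∀ X → InK Φ (M ↾ X)
    InK-↾ {M} M∈K X (local m R ψ) φ∈Φ a a∈ Ra =
      subst id (≡.sym (⟦⟧-cong ψ (↾-AgreeOn M X a∈)))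
        (M∈K _ φ∈Φ a (λ i → proj₁ (∈-filter⁻ (_∈? X) (a∈ i))) (proj₁ (Equivalence.to T-∧ Ra)))

    module Irreflexivity (irrΦ : ContainsIrr Φ) {M : Struct σ} (M∈K : InK Φ M) where

      rel-lookup-injective : ∀ {m} (r : Fin (σ (suc m))) t → T (rel M r t) →
                             ∀ {i j} → lookup t i ≡ lookup t j → i ≡ j
      rel-lookup-injective {m} r t Rt {i} {j} tᵢ≡tⱼ with i ≟ j
      ... | yes i≡j = i≡j
      ... | no  i≢j = ⊥-elim (M∈K (irr m r i j) (irrΦ m r i j i≢j) (lookup t)
                        (VAll-lookup (rel-in M r t Rt)) (subst (T ∘ rel M r) (≡.sym (tabulate∘lookup t)) Rt) tᵢ≡tⱼ)

      rel-Unique : ∀ {m} (r : Fin (σ (suc m))) t → T (rel M r t) → Unique (toList t)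
      rel-Unique r t Rt = subst Unique (≡.sym (toList≡tabulate∘lookup t))
                                (Unique.tabulate⁺ (rel-lookup-injective r t Rt))

      rel-repeated≡false : ∀ {p n} (r : Fin (σ n)) (a : Fin p → ℕ) (xs : Vec (Fin p) n) → p < n →
                       rel M r (vmap a xs) ≡ false
      rel-repeated≡false {n = suc _} r a xs p<n with Fin.pigeonhole p<n (lookup xs)
      ... | i , j , i<j , xsᵢ≡xsⱼ = ¬T⇒≡false λ Rt →
        Fin.<⇒≢ i<j (rel-lookup-injective r (vmap a xs) Rt (begin
          lookup (vmap a xs) i  ≡⟨ lookup-map i a xs ⟩
          a (lookup xs i)       ≡⟨ cong a xsᵢ≡xsⱼ ⟩
          a (lookup xs j)       ≡⟨ lookup-map j a xs ⟨
          lookup (vmap a xs) j  ∎))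
        where open ≡.≡-Reasoning

module Frames {σ : Signature} (Φ : Local σ → Set) (k : ℕ) where

  record Frame (S F : Struct σ) : Set where
    constructor frameOf
    field
      witness      : Struct σ
      witness-InK  : InK Φ witness
      witness-univ : univ witness ≡ univ S
      witness-low  : frame k witness ≈S frame k S
      is-frame     : F ≈S frame (suc k) witness

  open Frame public

  IsFrameOf⇒Frame : ∀ {S F} → IsFrameOf Φ S k F → Frame S F
  IsFrameOf⇒Frame (W , W∈K , W-univ , W-low , F≈W) = frameOf W W∈K W-univ W-low F≈W

  Frame⇒IsFrameOf : ∀ {S F} → Frame S F → IsFrameOf Φ S k F
  Frame⇒IsFrameOf (frameOf W W∈K W-univ W-low F≈W) = W , W∈K , W-univ , W-low , F≈W

  module _ {S F : Struct σ} (F-frame : Frame S F) where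

    private
      W : Struct σ
      W = witness F-frame

    witness-rel-below : ∀ {n} (r : Fin (σ n)) t → n ≤ k → rel W r t ≡ rel S r t
    witness-rel-below = frame-≈S⁻ {M = W} {N = S} (witness-low F-frame)

    Frame-univ : univ F ≡ univ S
    Frame-univ = ≡.trans (proj₁ (is-frame F-frame)) (witness-univ F-frame)

    Frame-rel-witness : ∀ {n} (r : Fin (σ n)) t → n ≤ suc k → rel F r t ≡ rel W r t
    Frame-rel-witness r t n≤1+k = ≡.trans (proj₂ (is-frame F-frame) _ r t) (rel-frame-≤ W r t n≤1+k)

    Frame-rel-below : ∀ {n} (r : Fin (σ n)) t → n ≤ k → rel F r t ≡ rel S r t
    Frame-rel-below r t n≤k =
      ≡.trans (Frame-rel-witness r t (ℕ.m≤n⇒m≤1+n n≤k)) (witness-rel-below r t n≤k)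

    Frame-rel-above : ∀ {n} (r : Fin (σ n)) t → suc k < n → rel F r t ≡ false
    Frame-rel-above r t 1+k<n = ≡.trans (proj₂ (is-frame F-frame) _ r t) (rel-frame-> W r t 1+k<n)

    Frame-↾ : ∀ X → Frame (S ↾ X) (F ↾ X)
    Frame-↾ X = frameOf (W ↾ X) (InK-↾ {M = W} (witness-InK F-frame) X)
      (cong (filter (_∈? X)) (witness-univ F-frame)) W↾X-low F↾X≈W↾X
      where
      open SetoidReasoning (Struct-setoid σ)
      W↾X-low : frame k (W ↾ X) ≈S frame k (S ↾ X)
      W↾X-low = begin
        frame k (W ↾ X)  ≈⟨ frame-↾ k W X ⟨
        frame k W ↾ X    ≈⟨ ↾-resp-≈S {A = frame k W} {frame k S} X (witness-low F-frame) ⟩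
        frame k S ↾ X    ≈⟨ frame-↾ k S X ⟩
        frame k (S ↾ X)  ∎
      F↾X≈W↾X : (F ↾ X) ≈S frame (suc k) (W ↾ X)
      F↾X≈W↾X = begin
        F ↾ X                  ≈⟨ ↾-resp-≈S {A = F} {frame (suc k) W} X (is-frame F-frame) ⟩
        frame (suc k) W ↾ X    ≈⟨ frame-↾ (suc k) W X ⟩
        frame (suc k) (W ↾ X)  ∎

  module _ (irrΦ : ContainsIrr Φ) {S F : Struct σ} (F-frame : Frame S F)
           (r : Fin (σ (suc k))) (t : Vec ℕ (suc k)) (Ft : T (rel F r t)) where

    private
      Wt : T (rel (witness F-frame) r t)
      Wt = subst T (Frame-rel-witness F-frame r t ℕ.≤-refl) Ft

    Frame-tuple-Unique : Unique (toList t)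
    Frame-tuple-Unique = Irreflexivity.rel-Unique irrΦ {M = witness F-frame} (witness-InK F-frame) r t Wt

    Frame-tuple-⊆ : VAll (_∈ univ S) t
    Frame-tuple-⊆ = subst (λ V → VAll (_∈ V) t) (witness-univ F-frame) (rel-in (witness F-frame) r t Wt)

-- Gluing (k+1)-frames of the restrictions of B to its (k+1)-subsets

module Gluing {σ : Signature} {Φ : Local σ → Set} (irrΦ : ContainsIrr Φ) (k : ℕ)
              (B : Struct σ) (B∈K : InK Φ B) where

  open Frames Φ k
  open Irreflexivity {Φ = Φ} irrΦ using (rel-repeated≡false)

  U : List ℕ
  U = univ B

  U! : Unique U
  U! = AllPairs.map ℕ.<⇒≢ (sorted B)

  Xs : List (List ℕ)
  Xs = choose (suc k) U

  Xs! : Unique Xs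
  Xs! = choose-Unique (suc k) U!

  tupleSupport : ∀ {n} → Vec ℕ n → List ℕ
  tupleSupport t = support U (toList t)

  tupleSupport∈Xs : (t : Vec ℕ (suc k)) → Unique (toList t) → VAll (_∈ U) t → tupleSupport t ∈ Xs
  tupleSupport∈Xs t t! t⊆U = support∈choose U! t! (VAll.toList⁺ t⊆U) (length-toList t)

  Xs-⊇⇒≡tupleSupport : ∀ {X} → X ∈ Xs → (t : Vec ℕ (suc k)) → Unique (toList t) →
                       VAll (_∈ X) t → X ≡ tupleSupport t
  Xs-⊇⇒≡tupleSupport X∈Xs t t! t⊆X =
    choose-⊇⇒≡support U! t! X∈Xs (length-toList t) (VAll.toList⁺ t⊆X)

  ⊆-B↾tupleSupport : ∀ {n} {t : Vec ℕ n} → VAll (_∈ U) t → VAll (_∈ univ (B ↾ tupleSupport t)) t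
  ⊆-B↾tupleSupport {t = t} t⊆U = VAll.toList⁻ (All.tabulate λ x∈t →
    let x∈U = All.lookup (VAll.toList⁺ t⊆U) x∈t
    in ∈-filter⁺ (_∈? tupleSupport t) x∈U (∈-filter⁺ (_∈? toList t) x∈U x∈t))

  ⊆-B↾⁻ : ∀ {n} X {t : Vec ℕ n} → VAll (_∈ univ (B ↾ X)) t → VAll (_∈ U) t × VAll (_∈ X) t
  ⊆-B↾⁻ X t⊆ = VAll.map (proj₁ ∘ ∈-filter⁻ (_∈? X) {xs = U}) t⊆ ,
               VAll.map (proj₂ ∘ ∈-filter⁻ (_∈? X) {xs = U}) t⊆

  Pieces : List (Struct σ) → Set
  Pieces = Pointwise (λ X P → Frame (B ↾ X) P) Xs

  Restricts : Struct σ → List (Struct σ) → Set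
  Restricts F = Pointwise (λ X P → (F ↾ X) ≈S P) Xs

  -- The conjunct `allIn U t` is redundant for pieces, but makes `rel-in` of `glue` immediate.
  anyPiece : ∀ {n} → List (Struct σ) → Fin (σ n) → Vec ℕ n → Bool
  anyPiece []       r t = false
  anyPiece (P ∷ Ps) r t = (rel P r t ∧ allIn U t) ∨ anyPiece Ps r t

  anyPiece-⊆ : ∀ {n} Ps (r : Fin (σ n)) t → T (anyPiece Ps r t) → VAll (_∈ U) t
  anyPiece-⊆ (P ∷ Ps) r t any with Equivalence.to (T-∨ {rel P r t ∧ allIn U t}) any
  ... | inj₁ Pt∧t⊆U = allIn-sound (proj₂ (Equivalence.to (T-∧ {rel P r t}) Pt∧t⊆U))
  ... | inj₂ any′   = anyPiece-⊆ Ps r t any′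

  anyPiece⁻ : ∀ {n} {R : List ℕ → Struct σ → Set} {Ys Ps} → Pointwise R Ys Ps →
              (r : Fin (σ n)) (t : Vec ℕ n) → T (anyPiece Ps r t) →
              ∃₂ λ Y P → Aligned Y P Ys Ps × T (rel P r t)
  anyPiece⁻ (_∷_ {x = Y} {y = P} _ RYsPs) r t any with Equivalence.to (T-∨ {rel P r t ∧ allIn U t}) any
  ... | inj₁ Pt∧t⊆U = Y , P , here , proj₁ (Equivalence.to (T-∧ {rel P r t}) Pt∧t⊆U)
  ... | inj₂ any′   = let Y′ , P′ , Y′↦P′ , P′t = anyPiece⁻ RYsPs r t any′ in Y′ , P′ , there Y′↦P′ , P′t

  anyPiece⁺ : ∀ {n} {Y : List ℕ} {P Ys Ps} → Aligned Y P Ys Ps → (r : Fin (σ n)) (t : Vec ℕ n) →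
              T (rel P r t) → VAll (_∈ U) t → T (anyPiece Ps r t)
  anyPiece⁺ {P = P} here r t Pt t⊆U = Equivalence.from T-∨
    (inj₁ (Equivalence.from (T-∧ {rel P r t}) (Pt , Equivalence.from T-≡ (allIn-true t⊆U))))
  anyPiece⁺ {Ps = Q ∷ _} (there Y↦P) r t Pt t⊆U =
    Equivalence.from (T-∨ {rel Q r t ∧ allIn U t}) (inj₂ (anyPiece⁺ Y↦P r t Pt t⊆U))

  glue : List (Struct σ) → Struct σ
  glue Ps = record { univ = U ; sorted = sorted B ; rel = rl ; rel-in = rl-in }
    where
    rl : ∀ {n} → Fin (σ n) → Vec ℕ n → Bool
    rl {n} r t = if n ≤ᵇ k then rel B r t else if n ≤ᵇ suc k then anyPiece Ps r t else false
    rl-in : ∀ {n} (r : Fin (σ n)) t → T (rl r t) → VAll (_∈ U) t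
    rl-in {n} r t Rt with n ≤ᵇ k | n ≤ᵇ suc k
    ... | true  | _     = rel-in B r t Rt
    ... | false | true  = anyPiece-⊆ Ps r t Rt
    ... | false | false = ⊥-elim Rt

  module _ (Ps : List (Struct σ)) where

    rel-glue-below : ∀ {n} (r : Fin (σ n)) t → n ≤ k → rel (glue Ps) r t ≡ rel B r t
    rel-glue-below r t n≤k rewrite ≤ᵇ-true n≤k = refl

    rel-glue-at : ∀ (r : Fin (σ (suc k))) t → rel (glue Ps) r t ≡ anyPiece Ps r t
    rel-glue-at r t rewrite ≤ᵇ-false (ℕ.n<1+n k) | ≤ᵇ-true (ℕ.≤-refl {suc k}) = refl

    rel-glue-above : ∀ {n} (r : Fin (σ n)) t → suc k < n → rel (glue Ps) r t ≡ false
    rel-glue-above r t 1+k<n rewrite ≤ᵇ-false (ℕ.<-trans (ℕ.n<1+n k) 1+k<n) | ≤ᵇ-false 1+k<n = refl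

  module _ {Ps : List (Struct σ)} (Ps-pieces : Pieces Ps) where

    piece : ∀ {X P} → Aligned X P Xs Ps → Frame (B ↾ X) P
    piece = Pointwise-Aligned Ps-pieces

    anyPiece-repeated≡false : ∀ {p} (r : Fin (σ (suc k))) (a : Fin p → ℕ) (xs : Vec (Fin p) (suc k)) →
                              p < suc k → anyPiece Ps r (vmap a xs) ≡ false
    anyPiece-repeated≡false r a xs p<1+k = ¬T⇒≡false λ any →
      let _ , _ , X↦P , Pt = anyPiece⁻ Ps-pieces r (vmap a xs) any
          W = witness (piece X↦P)
      in subst T (≡.trans (Frame-rel-witness (piece X↦P) r _ ℕ.≤-refl)
                          (rel-repeated≡false {M = W} (witness-InK (piece X↦P)) r a xs p<1+k)) Pt

    -- A (k+1)-tuple of a piece lists k+1 distinct elements, which span exactly one X ∈ Xs.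
    anyPiece-aligned : ∀ {X P} → Aligned X P Xs Ps → (r : Fin (σ (suc k))) (t : Vec ℕ (suc k)) →
                       VAll (_∈ X) t → anyPiece Ps r t ≡ rel P r t
    anyPiece-aligned {X} {P} X↦P r t t⊆X = T-ext any⇒Pt Pt⇒any
      where
      any⇒Pt : T (anyPiece Ps r t) → T (rel P r t)
      any⇒Pt any with anyPiece⁻ Ps-pieces r t any
      ... | Y , Q , Y↦Q , Qt = subst (λ P → T (rel P r t)) Q≡P Qt
        where
        t! : Unique (toList t)
        t! = Frame-tuple-Unique irrΦ (piece Y↦Q) r t Qt
        Y≡X : Y ≡ X
        Y≡X = ≡.trans
          (Xs-⊇⇒≡tupleSupport (Aligned-∈ Y↦Q) t t! (proj₂ (⊆-B↾⁻ Y (Frame-tuple-⊆ irrΦ (piece Y↦Q) r t Qt))))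
          (≡.sym (Xs-⊇⇒≡tupleSupport (Aligned-∈ X↦P) t t! t⊆X))
        Q≡P : Q ≡ P
        Q≡P = Aligned-functional Xs! (subst (λ Y → Aligned Y Q Xs Ps) Y≡X Y↦Q) X↦P
      Pt⇒any : T (rel P r t) → T (anyPiece Ps r t)
      Pt⇒any Pt = anyPiece⁺ X↦P r t Pt (proj₁ (⊆-B↾⁻ X (Frame-tuple-⊆ irrΦ (piece X↦P) r t Pt)))

    glue↾-at : ∀ {X P} → Aligned X P Xs Ps → (r : Fin (σ (suc k))) (t : Vec ℕ (suc k)) →
               VAll (_∈ univ (B ↾ X)) t → rel (glue Ps ↾ X) r t ≡ rel P r t
    glue↾-at {X} {P} X↦P r t t⊆ = begin
      rel (glue Ps ↾ X) r t  ≡⟨ rel-↾ (glue Ps) X r t⊆ ⟩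
      rel (glue Ps) r t      ≡⟨ rel-glue-at Ps r t ⟩
      anyPiece Ps r t        ≡⟨ anyPiece-aligned X↦P r t (proj₂ (⊆-B↾⁻ X t⊆)) ⟩
      rel P r t              ∎
      where open ≡.≡-Reasoning

    glue-↾ : ∀ {X P} → Aligned X P Xs Ps → (glue Ps ↾ X) ≈S P
    glue-↾ {X} {P} X↦P = ≡.sym (Frame-univ (piece X↦P)) , agree
      where
      agree : ∀ n (r : Fin (σ n)) t → rel (glue Ps ↾ X) r t ≡ rel P r t
      agree n r t with arityCase k n
      ... | below n≤k = ≡.trans (cong (_∧ allIn (univ (B ↾ X)) t) (rel-glue-below Ps r t n≤k))
                                (≡.sym (Frame-rel-below (piece X↦P) r t n≤k))
      ... | at = T-ext
        (λ glue↾t → subst T (glue↾-at X↦P r t (allIn-sound (proj₂ (Equivalence.to (T-∧ {rel (glue Ps) r t}) glue↾t))))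
                          glue↾t)
        (λ Pt → subst T (≡.sym (glue↾-at X↦P r t (Frame-tuple-⊆ irrΦ (piece X↦P) r t Pt))) Pt)
      ... | above 1+k<n = ≡.trans (cong (_∧ allIn (univ (B ↾ X)) t) (rel-glue-above Ps r t 1+k<n))
                                  (≡.sym (Frame-rel-above (piece X↦P) r t 1+k<n))

    glue-Restricts : Restricts (glue Ps) Ps
    glue-Restricts = Pointwise-tabulate Ps-pieces glue-↾

    glue-AgreeOn-B : ∀ {p} (a : Fin p → ℕ) → p ≤ k → AgreeOn (glue Ps) B a
    glue-AgreeOn-B a p≤k {n} r xs with arityCase k n
    ... | below n≤k   = rel-glue-below Ps r _ n≤k
    ... | at          = ≡.trans (rel-glue-at Ps r _) (≡.trans (anyPiece-repeated≡false r a xs (s≤s p≤k))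
                                (≡.sym (rel-repeated≡false {M = B} B∈K r a xs (s≤s p≤k))))
    ... | above 1+k<n = ≡.trans (rel-glue-above Ps r _ 1+k<n)
                                (≡.sym (rel-repeated≡false {M = B} B∈K r a xs (ℕ.<-trans (s≤s p≤k) 1+k<n)))

    glue-AgreeOn-piece : ∀ {X P} (X↦P : Aligned X P Xs Ps) (a : Fin (suc k) → ℕ) →
                         (∀ i → a i ∈ univ (B ↾ X)) → AgreeOn (glue Ps) (witness (piece X↦P)) a
    glue-AgreeOn-piece {X} {P} X↦P a a∈ {n} r xs with arityCase k n
    ... | below n≤k = begin
      rel (glue Ps) r (vmap a xs)             ≡⟨ rel-glue-below Ps r _ n≤k ⟩
      rel B r (vmap a xs)                     ≡⟨ rel-↾ B X r (VAll-vmap a xs a∈) ⟨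
      rel (B ↾ X) r (vmap a xs)               ≡⟨ witness-rel-below (piece X↦P) r _ n≤k ⟨
      rel (witness (piece X↦P)) r (vmap a xs) ∎
      where open ≡.≡-Reasoning
    ... | at = begin
      rel (glue Ps) r (vmap a xs)             ≡⟨ rel-glue-at Ps r _ ⟩
      anyPiece Ps r (vmap a xs)               ≡⟨ anyPiece-aligned X↦P r _ (proj₂ (⊆-B↾⁻ X (VAll-vmap a xs a∈))) ⟩
      rel P r (vmap a xs)                     ≡⟨ Frame-rel-witness (piece X↦P) r _ ℕ.≤-refl ⟩
      rel (witness (piece X↦P)) r (vmap a xs) ∎
      where open ≡.≡-Reasoning
    ... | above 1+k<n = ≡.trans (rel-glue-above Ps r _ 1+k<n)
      (≡.sym (rel-repeated≡false {M = witness (piece X↦P)} (witness-InK (piece X↦P)) r a xs 1+k<n))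

    -- A local sentence only inspects tuples over the entries of its guard tuple; these agree with B
    -- if the guard has arity ≤ k, and with the unique piece containing the guard if it has arity k+1.
    glue-InK : InK Φ (glue Ps)
    glue-InK (local m R ψ) φ∈Φ a a∈U Ra with arityCase k (suc m)
    ... | below 1+m≤k = subst id (≡.sym (⟦⟧-cong ψ (glue-AgreeOn-B a 1+m≤k)))
                              (B∈K _ φ∈Φ a a∈U (subst T (rel-glue-below Ps R _ 1+m≤k) Ra))
    ... | above 1+k<1+m = ⊥-elim (subst T (rel-glue-above Ps R _ 1+k<1+m) Ra)
    ... | at with anyPiece⁻ Ps-pieces R (tabulate a) (subst T (rel-glue-at Ps R _) Ra)
    ...   | X , P , X↦P , Pa = subst id (≡.sym (⟦⟧-cong ψ (glue-AgreeOn-piece X↦P a a∈B↾X)))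
                                        (witness-InK (piece X↦P) _ φ∈Φ a a∈W Wa)
      where
      W : Struct σ
      W = witness (piece X↦P)
      Wa : T (rel W R (tabulate a))
      Wa = subst T (Frame-rel-witness (piece X↦P) R _ ℕ.≤-refl) Pa
      a∈W : ∀ i → a i ∈ univ W
      a∈W = VAll.tabulate⁻ (rel-in W R (tabulate a) Wa)
      a∈B↾X : ∀ i → a i ∈ univ (B ↾ X)
      a∈B↾X = subst (λ V → ∀ i → a i ∈ V) (witness-univ (piece X↦P)) a∈W

    glue-Frame : Frame B (glue Ps)
    glue-Frame = frameOf (glue Ps) glue-InK refl
      (frame-≈S {M = glue Ps} {N = B} refl (λ r t → rel-glue-below Ps r t))
      (≈S-frame (glue Ps) (λ r t → rel-glue-above Ps r t))

  Restricts-↾ : ∀ {F G Ps} → Restricts F Ps → Restricts G Ps → ∀ {X} → X ∈ Xs → (F ↾ X) ≈S (G ↾ X)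
  Restricts-↾ {F} {G} F↾≈Ps G↾≈Ps {X} X∈Xs with Pointwise⇒Aligned F↾≈Ps X∈Xs
  ... | P , X↦P = ≈S-trans {A = F ↾ X} {P} {G ↾ X} (Pointwise-Aligned F↾≈Ps X↦P)
                           (≈S-sym {A = G ↾ X} {P} (Pointwise-Aligned G↾≈Ps X↦P))

  -- By irreflexivity a (k+1)-tuple of F spans a set X ∈ Xs, so it is a tuple of F ↾ X.
  Frame-rel-at-transfer : ∀ {F G} → Frame B F → (∀ {X} → X ∈ Xs → (F ↾ X) ≈S (G ↾ X)) →
                          (r : Fin (σ (suc k))) (t : Vec ℕ (suc k)) → T (rel F r t) → T (rel G r t)
  Frame-rel-at-transfer {F} {G} F-frame F≈G r t Ft =
    proj₁ (Equivalence.to (T-∧ {rel G r t}) (subst T (proj₂ (F≈G X∈Xs) _ r t) F↾Xt))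
    where
    t⊆U : VAll (_∈ U) t
    t⊆U = Frame-tuple-⊆ irrΦ F-frame r t Ft
    X : List ℕ
    X = tupleSupport t
    X∈Xs : X ∈ Xs
    X∈Xs = tupleSupport∈Xs t (Frame-tuple-Unique irrΦ F-frame r t Ft) t⊆U
    t⊆F↾X : VAll (_∈ univ (F ↾ X)) t
    t⊆F↾X = subst (λ V → VAll (_∈ filter (_∈? X) V) t) (≡.sym (Frame-univ F-frame)) (⊆-B↾tupleSupport t⊆U)
    F↾Xt : T (rel (F ↾ X) r t)
    F↾Xt = subst T (≡.sym (rel-↾ F X r t⊆F↾X)) Ft

  Frame-↾-injective : ∀ {F G} → Frame B F → Frame B G → (∀ {X} → X ∈ Xs → (F ↾ X) ≈S (G ↾ X)) → F ≈S G
  Frame-↾-injective {F} {G} F-frame G-frame F≈G = ≡.trans (Frame-univ F-frame) (≡.sym (Frame-univ G-frame)) , agree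
    where
    agree : ∀ n (r : Fin (σ n)) t → rel F r t ≡ rel G r t
    agree n r t with arityCase k n
    ... | below n≤k   = ≡.trans (Frame-rel-below F-frame r t n≤k) (≡.sym (Frame-rel-below G-frame r t n≤k))
    ... | at          = T-ext (Frame-rel-at-transfer {G = G} F-frame F≈G r t)
                              (Frame-rel-at-transfer {G = F} G-frame (λ {X} X∈ → ≈S-sym {A = F ↾ X} {G ↾ X} (F≈G X∈)) r t)
    ... | above 1+k<n = ≡.trans (Frame-rel-above F-frame r t 1+k<n) (≡.sym (Frame-rel-above G-frame r t 1+k<n))

  ≈S-glue : ∀ {F Ps} → Frame B F → Pieces Ps → Restricts F Ps → F ≈S glue Ps
  ≈S-glue {F} {Ps} F-frame Ps-pieces F↾≈Ps = Frame-↾-injective F-frame (glue-Frame Ps-pieces)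
    (Restricts-↾ {F = F} {G = glue Ps} F↾≈Ps (glue-Restricts Ps-pieces))

  glue-injective : ∀ {Ps Qs} → Pieces Ps → Pieces Qs → glue Ps ≈S glue Qs → Pointwise _≈S_ Ps Qs
  glue-injective {Ps} {Qs} Ps-pieces Qs-pieces glue≈ =
    Pointwise.transitive {R = λ P X → P ≈S (glue Ps ↾ X)} {S = λ X Q → (glue Qs ↾ X) ≈S Q} {T = _≈S_ {σ}}
      (λ {P} {X} {Q} → step {P} {X} {Q})
      (Pointwise.symmetric {R = λ X P → (glue Ps ↾ X) ≈S P} (λ {X} {P} → ≈S-sym {A = glue Ps ↾ X} {P})
                           (glue-Restricts Ps-pieces))
      (glue-Restricts Qs-pieces)
    where
    step : ∀ {P X Q} → P ≈S (glue Ps ↾ X) → (glue Qs ↾ X) ≈S Q → P ≈S Q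
    step {P} {X} {Q} P≈ ≈Q = begin
      P            ≈⟨ P≈ ⟩
      glue Ps ↾ X  ≈⟨ ↾-resp-≈S {A = glue Ps} {glue Qs} X glue≈ ⟩
      glue Qs ↾ X  ≈⟨ ≈Q ⟩
      Q            ∎
      where open SetoidReasoning (Struct-setoid σ)

  FrameList : List ℕ → List (Struct σ) → Set
  FrameList X Fs = All (IsFrameOf Φ (B ↾ X) k) Fs × Uniqueₛ (Struct-setoid σ) Fs ×
                   (∀ F → IsFrameOf Φ (B ↾ X) k F → Any (F ≈S_) Fs)

  IsN-product : (m : List ℕ → ℕ) → All (λ X → IsN Φ (B ↾ X) k (m X)) Xs → IsN Φ B k (product (map m Xs))
  IsN-product m Ns with All-unzipΣ {R = FrameList} Ns
  ... | Ls , Ls-lengths , Ls-lists = map glue (choices Ls) , length-glued , glued-frames , glued-Unique , glued-complete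
    where
    choice-Pieces : ∀ {c} → Pointwise _∈_ c Ls → Pieces c
    choice-Pieces c∈Ls = Pointwise.map IsFrameOf⇒Frame (Pointwise-All-∈ (Pointwise.map proj₁ Ls-lists) c∈Ls)

    length-glued : length (map glue (choices Ls)) ≡ product (map m Xs)
    length-glued = begin
      length (map glue (choices Ls))  ≡⟨ length-map glue (choices Ls) ⟩
      length (choices Ls)             ≡⟨ length-choices Ls ⟩
      product (map length Ls)         ≡⟨ cong product Ls-lengths ⟩
      product (map m Xs)              ∎
      where open ≡.≡-Reasoning

    glued-frames : All (IsFrameOf Φ B k) (map glue (choices Ls))
    glued-frames = All.map⁺ (All.map (Frame⇒IsFrameOf ∘ glue-Frame ∘ choice-Pieces) (choices⁻ Ls))

    glued-Unique : Uniqueₛ (Struct-setoid σ) (map glue (choices Ls))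
    glued-Unique = Unique-map⁺-injectiveOn (Pointwise.setoid (Struct-setoid σ)) (Struct-setoid σ)
      (λ c∈Ls c′∈Ls → glue-injective (choice-Pieces c∈Ls) (choice-Pieces c′∈Ls)) (choices⁻ Ls)
      (choices-Unique (Struct-setoid σ) (Pointwise-All (Pointwise.map (proj₁ ∘ proj₂) Ls-lists)))

    glued-complete : ∀ F → IsFrameOf Φ B k F → Any (F ≈S_) (map glue (choices Ls))
    glued-complete F F-isFrame with Pointwise-Any⇒choice restrictions-listed
      where
      restrictions-listed : Pointwise (λ X Fs → Any ((F ↾ X) ≈S_) Fs) Xs Ls
      restrictions-listed = Pointwise-tabulate Ls-lists λ {X} X↦Fs →
        proj₂ (proj₂ (Pointwise-Aligned Ls-lists X↦Fs)) (F ↾ X)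
              (Frame⇒IsFrameOf (Frame-↾ (IsFrameOf⇒Frame {B} {F} F-isFrame) X))
    ... | c , c∈Ls , F↾≈c = Any.map⁺ (Any.map (λ { refl → F≈glue-c }) (choices⁺ Ls c∈Ls))
      where
      F≈glue-c : F ≈S glue c
      F≈glue-c = ≈S-glue (IsFrameOf⇒Frame {B} {F} F-isFrame) (choice-Pieces c∈Ls) F↾≈c

IsN-functional : ∀ {σ} (Φ : Local σ → Set) S k {n n′} → IsN Φ S k n → IsN Φ S k n′ → n ≡ n′
IsN-functional {σ} Φ S k (Fs , refl , Fs-frames , Fs! , Fs-complete) (Gs , refl , Gs-frames , Gs! , Gs-complete) =
  Unique-⊆-⊇⇒length≡ (Struct-setoid σ) Fs! Gs!
    (All.map (λ {F} → Gs-complete F) Fs-frames) (All.map (λ {G} → Fs-complete G) Gs-frames)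

lemma5p8 : (σ : Signature) (Φ : Local σ → Set) → ContainsIrr Φ →
    (B : Struct σ) → InK Φ B → (k : ℕ) → k < length (univ B) →
    (m : List ℕ → ℕ) →
    (∀ X → X ∈ choose (suc k) (univ B) → IsN Φ (B ↾ X) k (m X)) →
    IsN Φ B k (product (map m (choose (suc k) (univ B))))
    × (∀ n → IsN Φ B k n → n ≡ product (map m (choose (suc k) (univ B))))
lemma5p8 σ Φ irrΦ B B∈K k _ m N↾ = N≡product , λ n N≡n → IsN-functional Φ B k N≡n N≡product
  where
  N≡product : IsN Φ B k (product (map m (choose (suc k) (univ B))))
  N≡product = Gluing.IsN-product irrΦ k B B∈K m (All.tabulate (N↾ _))
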